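{- If $n\ge 1$, then ${\rm gt}(K_n \,\square\, K_n) = n^2 - 2n + 2$.
   Context: $K_n$ is the complete graph on $n$ vertices and $\square$ denotes the Cartesian product: $G\,\square\,H$ has vertex set $V(G)\times V(H)$, with $(g,h)$ adjacent to $(g',h')$ iff either $g=g'$ and $hh'\in E(H)$, or $h=h'$ and $gg'\in E(G)$. A geodesic is a shortest path; it is maximal if it is not contained as a subpath in any other geodesic. A set $S$ of vertices of $G$ is a geodesic transversal if every maximal geodesic of $G$ contains a vertex of $S$; ${\rm gt}(G)$ is the minimum cardinality of a geodesic transversal. -}

module Defs where

open import Data.Nat using (ℕ; _≤_)
open import Data.Fin using (Fin)
open import Data.Product using (_×_; _,_; Σ; ∃)
open import Data.Sum using (_⊎_)
open import Data.Maybe using (just)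
open import Data.List using (List; []; length; head; last)
open import Data.List.Relation.Unary.Any using (Any)
open import Data.List.Relation.Unary.Unique.Propositional using (Unique)
open import Data.List.Relation.Unary.Linked using (Linked)
open import Data.List.Membership.Propositional using (_∈_)
open import Data.List.Relation.Binary.Infix.Heterogeneous using (Infix)
open import Relation.Binary.PropositionalEquality using (_≡_; _≢_)
open import Relation.Nullary using (¬_)

record Graph : Set₁ where
  field
    V   : Set
    Adj : V → V → Set

open Graph public

K : ℕ → Graph
K n = record { V = Fin n ; Adj = λ i j → i ≢ j }

_□_ : Graph → Graph → Graph
G □ H = record
  { V   = V G × V H
  ; Adj = λ { (g , h) (g' , h') → (g ≡ g' × Adj H h h') ⊎ (h ≡ h' × Adj G g g') }
  }

module _ (G : Graph) where

  IsPath : List (V G) → Set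
  IsPath P = ¬ (P ≡ []) × Linked (Adj G) P × Unique P

  PathFromTo : V G → V G → List (V G) → Set
  PathFromTo u v P = IsPath P × head P ≡ just u × last P ≡ just v

  -- A geodesic: a u,v-path with no shorter u,v-path
  -- (length measured in vertices; equivalent to measuring in edges).
  IsGeodesic : List (V G) → Set
  IsGeodesic P = Σ (V G) λ u → Σ (V G) λ v →
    PathFromTo u v P × (∀ Q → PathFromTo u v Q → length P ≤ length Q)

  IsMaximalGeodesic : List (V G) → Set
  IsMaximalGeodesic P = IsGeodesic P ×
    (∀ Q → IsGeodesic Q → Infix _≡_ P Q → Q ≡ P)

  IsGeodesicTransversal : List (V G) → Set
  IsGeodesicTransversal S = Unique S ×
    (∀ P → IsMaximalGeodesic P → Any (_∈ S) P)

  GtIs : ℕ → Set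
  GtIs k = (Σ (List (V G)) λ S → IsGeodesicTransversal S × length S ≡ k)
         × (∀ S → IsGeodesicTransversal S → k ≤ length S)

-- In K m □ K n with m, n ≥ 2 any two cells are at distance at most 2, so the maximal geodesics
-- are exactly the ells (a,b) (a,d) (c,d) with a ≠ c and b ≠ d, read in either direction; hence S
-- is a geodesic transversal iff its complement T contains no ell. In an ell-free T a cell sharing
-- its row with another cell of T is alone in its column. Labelling such cells by their column and
-- all other cells by their row is injective on T and leaves at least two of the m + n lines
-- unused, so |T| ≤ m + n - 2. The cells whose coordinates are both zero or both nonzero attain
-- this, giving gt(K m □ K n) = mn - m - n + 2, which is n² - 2n + 2 for the square.

module Submission where

open import Defs
open import Data.Nat using (ℕ; zero; suc; _≤_; _*_; _+_; _∸_; z≤n; s≤s)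
open import Data.Nat.Properties
  using (≤-trans; ≤-antisym; 1+n≰n; +-assoc; +-comm; +-cancelʳ-≤; +-monoˡ-≤; +-monoʳ-≤; m+n∸n≡m; module ≤-Reasoning)
open import Data.Nat.Tactic.RingSolver using (solve-∀)
open import Data.Fin using (Fin; zero; suc; punchIn; _≟_)
open import Data.Fin.Properties using (injective⇒≤; punchInᵢ≢i)
open import Data.Product using (_×_; _,_; ∃; ∃₂; proj₁; proj₂)
open import Data.Product.Properties using (≡-dec)
open import Data.Sum using (_⊎_; inj₁; inj₂; [_,_]′)
open import Data.Sum.Properties using (inj₁-injective; inj₂-injective)
open import Data.List
  using (List; []; _∷_; length; map; _++_; lookup; reverse; filter; allFin; cartesianProduct; cartesianProductWith)
open import Data.List.Properties using (length-map; length-++; length-tabulate)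
open import Data.List.Relation.Unary.Any using (Any; here; there; index; any?)
open import Data.List.Relation.Unary.Any.Properties using (lookup-index; reverse⁻)
open import Data.List.Relation.Unary.All as All using (All; []; _∷_)
open import Data.List.Relation.Unary.All.Properties using (¬Any⇒All¬) renaming (map⁺ to all-map⁺)
open import Data.List.Relation.Unary.AllPairs using ([]; _∷_)
open import Data.List.Relation.Unary.Linked using ([-]; _∷_)
open import Data.List.Relation.Unary.Unique.Propositional using (Unique)
open import Data.List.Relation.Unary.Unique.Propositional.Properties
  using (allFin⁺; cartesianProduct⁺; cartesianProductWith⁺) renaming (filter⁺ to unique-filter⁺)
open import Data.List.Membership.Propositional using (_∈_; _∉_; lose; find)
open import Data.List.Membership.Propositional.Properties
  using (∈-lookup; ∈-map⁺; ∈-map⁻; ∈-allFin; ∈-cartesianProductWith⁺; ∈-cartesianProductWith⁻;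
         ∈-filter⁺; ∈-filter⁻; ∈-++⁺ˡ; ∈-++⁺ʳ)
open import Data.List.Relation.Binary.Subset.Propositional using (_⊆_)
open import Data.List.Relation.Binary.Pointwise using (Pointwise-≡⇒≡)
open import Data.List.Relation.Binary.Prefix.Heterogeneous.Properties as Prefix using (toPointwise)
open import Data.List.Relation.Binary.Infix.Heterogeneous using (Infix; here; there)
open import Data.List.Relation.Binary.Prefix.Heterogeneous using ([]; _∷_)
open import Data.List.Relation.Binary.Infix.Heterogeneous.Properties as Infix using ()
open import Function using (_∘_; id)
open import Relation.Binary.PropositionalEquality using (_≡_; _≢_; refl; sym; trans; cong; cong₂; subst; module ≡-Reasoning)
open import Relation.Nullary using (¬_; Dec; yes; no; ¬?; _×-dec_; contradiction)
open import Relation.Unary using (Decidable)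

private
  variable
    A B C : Set
    xs ys : List A

lookup-injective : Unique xs → ∀ {i j} → lookup xs i ≡ lookup xs j → i ≡ j
lookup-injective (x∉xs ∷ _)  {zero}  {zero}  _  = refl
lookup-injective (x∉xs ∷ _)  {zero}  {suc j} eq = contradiction eq (All.lookup x∉xs (∈-lookup j))
lookup-injective (x∉xs ∷ _)  {suc i} {zero}  eq = contradiction (sym eq) (All.lookup x∉xs (∈-lookup i))
lookup-injective (_ ∷ xs!)   {suc i} {suc j} eq = cong suc (lookup-injective xs! eq)

unique-⊆⇒length≤ : Unique xs → xs ⊆ ys → length xs ≤ length ys
unique-⊆⇒length≤ {xs = xs} {ys = ys} xs! xs⊆ys = injective⇒≤ position-injective
  where
  position : Fin (length xs) → Fin (length ys)
  position i = index (xs⊆ys (∈-lookup i))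

  position-injective : ∀ {i j} → position i ≡ position j → i ≡ j
  position-injective {i} {j} eq = lookup-injective xs! (begin
    lookup xs i             ≡⟨ lookup-index (xs⊆ys (∈-lookup i)) ⟩
    lookup ys (position i)  ≡⟨ cong (lookup ys) eq ⟩
    lookup ys (position j)  ≡⟨ lookup-index (xs⊆ys (∈-lookup j)) ⟨
    lookup xs j             ∎)
    where open ≡-Reasoning

unique-map⁺ : (f : A → B) → (∀ {x y} → x ∈ xs → y ∈ xs → f x ≡ f y → x ≡ y) →
              Unique xs → Unique (map f xs)
unique-map⁺ f f-inj [] = []
unique-map⁺ f f-inj (x∉xs ∷ xs!) =
  all-map⁺ (All.tabulate λ y∈xs fx≡fy → All.lookup x∉xs y∈xs (f-inj (here refl) (there y∈xs) fx≡fy))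
  ∷ unique-map⁺ f (λ x∈ y∈ → f-inj (there x∈) (there y∈)) xs!

length-cartesianProductWith : ∀ (f : A → B → C) xs ys →
                              length (cartesianProductWith f xs ys) ≡ length xs * length ys
length-cartesianProductWith f []       ys = refl
length-cartesianProductWith f (x ∷ xs) ys = begin
  length (map (f x) ys ++ cartesianProductWith f xs ys)
    ≡⟨ length-++ (map (f x) ys) ⟩
  length (map (f x) ys) + length (cartesianProductWith f xs ys)
    ≡⟨ cong₂ _+_ (length-map (f x) ys) (length-cartesianProductWith f xs ys) ⟩
  length ys + length xs * length ys
    ∎
  where open ≡-Reasoning

length-allFin : ∀ n → length (allFin n) ≡ n
length-allFin n = length-tabulate id

infix-≡ : Infix _≡_ xs ys → length ys ≤ length xs → ys ≡ xs
infix-≡ (here xs≼ys) ys≤xs =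
  sym (Pointwise-≡⇒≡ (toPointwise (≤-antisym (Prefix.length-mono xs≼ys) ys≤xs) xs≼ys))
infix-≡ (there xs⊑ys) ys≤xs = contradiction (≤-trans ys≤xs (Infix.length-mono xs⊑ys)) 1+n≰n

module _ (G : Graph) where

  path₁ : ∀ u → PathFromTo G u u (u ∷ [])
  path₁ u = ((λ ()) , [-] , [] ∷ []) , refl , refl

  path₂ : ∀ {u v} → u ≢ v → Adj G u v → PathFromTo G u v (u ∷ v ∷ [])
  path₂ u≢v uv = ((λ ()) , uv ∷ [-] , (u≢v ∷ []) ∷ [] ∷ []) , refl , refl

  path₃ : ∀ {x y z} → x ≢ y → x ≢ z → y ≢ z → Adj G x y → Adj G y z →
          PathFromTo G x z (x ∷ y ∷ z ∷ [])
  path₃ x≢y x≢z y≢z xy yz =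
    ((λ ()) , xy ∷ yz ∷ [-] , (x≢y ∷ x≢z ∷ []) ∷ (y≢z ∷ []) ∷ [] ∷ []) , refl , refl

  nonadjacent⇒3≤length : ∀ {u v Q} → u ≢ v → ¬ Adj G u v → PathFromTo G u v Q → 3 ≤ length Q
  nonadjacent⇒3≤length {Q = []}            _   _    ((Q≢[] , _) , _)                   = contradiction refl Q≢[]
  nonadjacent⇒3≤length {Q = _ ∷ []}        u≢v _    (_ , refl , refl)                  = contradiction refl u≢v
  nonadjacent⇒3≤length {Q = _ ∷ _ ∷ []}    _   ¬adj ((_ , uv ∷ [-] , _) , refl , refl) = contradiction uv ¬adj
  nonadjacent⇒3≤length {Q = _ ∷ _ ∷ _ ∷ _} _   _    _                                  = s≤s (s≤s (s≤s z≤n))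

  path₃-isMaximalGeodesic : (∀ {P} → IsGeodesic G P → length P ≤ 3) →
                            ∀ {x y z} → x ≢ z → ¬ Adj G x z →
                            PathFromTo G x z (x ∷ y ∷ z ∷ []) → IsMaximalGeodesic G (x ∷ y ∷ z ∷ [])
  path₃-isMaximalGeodesic diameter x≢z ¬adj xyz =
    (_ , _ , xyz , λ Q → nonadjacent⇒3≤length x≢z ¬adj) ,
    λ Q Q-geodesic P⊑Q → infix-≡ P⊑Q (diameter Q-geodesic)

-- The rook's graph K m □ K n

Cell : ℕ → ℕ → Set
Cell m n = Fin m × Fin n

data IsEll {m n} : List (Cell m n) → Set where
  ell : ∀ {a b c d} → a ≢ c → b ≢ d → IsEll ((a , b) ∷ (a , d) ∷ (c , d) ∷ [])

module _ {m n : ℕ} where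

  private
    R = K m □ K n

  adj⇒≢ : ∀ {u v} → Adj R u v → u ≢ v
  adj⇒≢ (inj₁ (_ , b≢d)) = b≢d ∘ cong proj₂
  adj⇒≢ (inj₂ (_ , a≢c)) = a≢c ∘ cong proj₁

  nonadjacent : ∀ {a b c d} → a ≢ c → b ≢ d → ¬ Adj R (a , b) (c , d)
  nonadjacent a≢c _   (inj₁ (a≡c , _)) = a≢c a≡c
  nonadjacent _   b≢d (inj₂ (b≡d , _)) = b≢d b≡d

  path≤3 : (u v : Cell m n) → ∃ λ Q → PathFromTo R u v Q × length Q ≤ 3
  path≤3 (a , b) (c , d) with a ≟ c | b ≟ d
  ... | yes refl | yes refl = _ , path₁ R (a , b) , s≤s z≤n
  ... | yes refl | no b≢d   = _ , path₂ R (b≢d ∘ cong proj₂) (inj₁ (refl , b≢d)) , s≤s (s≤s z≤n)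
  ... | no a≢c   | yes refl = _ , path₂ R (a≢c ∘ cong proj₁) (inj₂ (refl , a≢c)) , s≤s (s≤s z≤n)
  ... | no a≢c   | no b≢d   =
    _ , path₃ R (b≢d ∘ cong proj₂) (a≢c ∘ cong proj₁) (a≢c ∘ cong proj₁)
                (inj₁ (refl , b≢d)) (inj₂ (refl , a≢c)) ,
    s≤s (s≤s (s≤s z≤n))

  geodesic-length≤3 : ∀ {P} → IsGeodesic R P → length P ≤ 3
  geodesic-length≤3 (u , v , _ , shortest) with Q , uQv , Q≤3 ← path≤3 u v = ≤-trans (shortest Q uQv) Q≤3

  ell-isMaximalGeodesic : ∀ {P} → IsEll P → IsMaximalGeodesic R P
  ell-isMaximalGeodesic (ell {a} {b} {c} {d} a≢c b≢d) =
    path₃-isMaximalGeodesic R geodesic-length≤3 (a≢c ∘ cong proj₁) (nonadjacent a≢c b≢d)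
      (path₃ R (adj⇒≢ ab-ad) (a≢c ∘ cong proj₁) (adj⇒≢ ad-cd) ab-ad ad-cd)
    where
    ab-ad : Adj R (a , b) (a , d)
    ab-ad = inj₁ (refl , b≢d)

    ad-cd : Adj R (a , d) (c , d)
    ad-cd = inj₂ (refl , a≢c)

  path₃⇒ell : ∀ {x y z} → Adj R x y → Adj R y z → x ≢ z → ¬ Adj R x z →
              IsEll (x ∷ y ∷ z ∷ []) ⊎ IsEll (z ∷ y ∷ x ∷ [])
  path₃⇒ell (inj₁ (refl , _))   (inj₁ (refl , _))   x≢z ¬xz =
    contradiction (inj₁ (refl , x≢z ∘ cong (_ ,_))) ¬xz
  path₃⇒ell (inj₁ (refl , b≢d)) (inj₂ (refl , a≢c)) _   _   = inj₁ (ell a≢c b≢d)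
  path₃⇒ell (inj₂ (refl , a≢c)) (inj₁ (refl , b≢d)) _   _   = inj₂ (ell (a≢c ∘ sym) (b≢d ∘ sym))
  path₃⇒ell (inj₂ (refl , _))   (inj₂ (refl , _))   x≢z ¬xz =
    contradiction (inj₂ (refl , x≢z ∘ cong (_, _))) ¬xz

  inside-ell⇒¬maximal : ∀ {P Q} → IsEll Q → Infix _≡_ P Q → length P ≢ 3 →
                        ¬ (∀ Q → IsGeodesic R Q → Infix _≡_ P Q → Q ≡ P)
  inside-ell⇒¬maximal {Q = Q} Q-ell@(ell _ _) P⊑Q P≢3 maximal =
    P≢3 (sym (cong length (maximal Q (proj₁ (ell-isMaximalGeodesic Q-ell)) P⊑Q)))

module _ {m n : ℕ} where

  private
    R = K (suc (suc m)) □ K (suc (suc n))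

  -- With at least two rows and columns, every geodesic on fewer than three cells lies inside an ell.
  maximalGeodesic⇒ell : ∀ {P} → IsMaximalGeodesic R P → IsEll P ⊎ IsEll (reverse P)
  maximalGeodesic⇒ell {[]} ((_ , _ , ((P≢[] , _) , _) , _) , _) = contradiction refl P≢[]
  maximalGeodesic⇒ell {(a , b) ∷ []} (_ , maximal) =
    contradiction maximal (inside-ell⇒¬maximal (ell {c = punchIn a zero} {d = punchIn b zero}
      (punchInᵢ≢i a zero ∘ sym) (punchInᵢ≢i b zero ∘ sym)) (here (refl ∷ [])) λ ())
  maximalGeodesic⇒ell {(a , b) ∷ (_ , d) ∷ []} ((_ , _ , ((_ , inj₁ (refl , b≢d) ∷ [-] , _) , _) , _) , maximal) =
    contradiction maximal (inside-ell⇒¬maximal (ell {c = punchIn a zero} (punchInᵢ≢i a zero ∘ sym) b≢d)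
      (here (refl ∷ refl ∷ [])) λ ())
  maximalGeodesic⇒ell {(a , b) ∷ (c , _) ∷ []} ((_ , _ , ((_ , inj₂ (refl , a≢c) ∷ [-] , _) , _) , _) , maximal) =
    contradiction maximal (inside-ell⇒¬maximal (ell {b = punchIn b zero} a≢c (punchInᵢ≢i b zero))
      (there (here (refl ∷ refl ∷ []))) λ ())
  maximalGeodesic⇒ell {x ∷ y ∷ z ∷ []}
    ((_ , _ , ((_ , xy ∷ yz ∷ [-] , (_ ∷ x≢z ∷ []) ∷ _) , refl , refl) , shortest) , _) =
    path₃⇒ell xy yz x≢z λ xz → contradiction (shortest _ (path₂ R x≢z xz)) λ { (s≤s (s≤s ())) }
  maximalGeodesic⇒ell {_ ∷ _ ∷ _ ∷ _ ∷ _} (geodesic , _) with s≤s (s≤s (s≤s ())) ← geodesic-length≤3 geodesic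

MeetsEveryEll : ∀ {m n} → List (Cell m n) → Set
MeetsEveryEll S = ∀ {P} → IsEll P → Any (_∈ S) P

EllFree : ∀ {m n} → List (Cell m n) → Set
EllFree T = ∀ {P} → IsEll P → ¬ All (_∈ T) P

transversal⇒meetsEveryEll : ∀ {m n S} → IsGeodesicTransversal (K m □ K n) S → MeetsEveryEll S
transversal⇒meetsEveryEll (_ , hits) P-ell = hits _ (ell-isMaximalGeodesic P-ell)

meetsEveryEll⇒transversal : ∀ {m n} {S : List (Cell (suc (suc m)) (suc (suc n)))} →
                            Unique S → MeetsEveryEll S → IsGeodesicTransversal (K _ □ K _) S
meetsEveryEll⇒transversal S! meets = S! , λ P maximal → [ meets , reverse⁻ ∘ meets ]′ (maximalGeodesic⇒ell maximal)

-- Ell-free sets of cells are small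

_≟ᶜ_ : ∀ {m n} (u v : Cell m n) → Dec (u ≡ v)
_≟ᶜ_ = ≡-dec _≟_ _≟_

module EllFreeLabelling {m n} {T : List (Cell m n)} (T-ellFree : EllFree T) where

  RowMate : Cell m n → Set
  RowMate v = Any (λ u → proj₁ u ≡ proj₁ v × u ≢ v) T

  rowMate? : Decidable RowMate
  rowMate? v = any? (λ u → (proj₁ u ≟ proj₁ v) ×-dec ¬? (u ≟ᶜ v)) T

  unmated-alone-in-row : ∀ {u v} → ¬ RowMate v → u ∈ T → proj₁ u ≡ proj₁ v → u ≡ v
  unmated-alone-in-row {u} {v} unmated u∈T same-row with u ≟ᶜ v
  ... | yes u≡v = u≡v
  ... | no u≢v  = contradiction (lose u∈T (same-row , u≢v)) unmated

  mated-alone-in-column : ∀ {u v} → v ∈ T → RowMate v → u ∈ T → proj₂ u ≡ proj₂ v → u ≡ v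
  mated-alone-in-column {c , _} {a , d} v∈T mated u∈T refl with find mated | c ≟ a
  ... | _ | yes refl = refl
  ... | (_ , b) , w∈T , refl , w≢v | no c≢a =
    contradiction (w∈T ∷ v∈T ∷ u∈T ∷ []) (T-ellFree (ell (c≢a ∘ sym) (w≢v ∘ cong (a ,_))))

  -- A cell with a row-mate is alone in its column, so labelling it by its column loses nothing.
  label : Cell m n → Fin m ⊎ Fin n
  label v with rowMate? v
  ... | yes _ = inj₂ (proj₂ v)
  ... | no _  = inj₁ (proj₁ v)

  label-injective : ∀ {u v} → u ∈ T → v ∈ T → label u ≡ label v → u ≡ v
  label-injective {u} {v} u∈T v∈T eq with rowMate? u | rowMate? v
  ... | no _     | no ¬mv  = unmated-alone-in-row ¬mv u∈T (inj₁-injective eq)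
  ... | yes _    | yes mv  = mated-alone-in-column v∈T mv u∈T (inj₂-injective eq)
  ... | no _     | yes _ with () ← eq
  ... | yes _    | no _  with () ← eq

  row-label⇒unmated : ∀ {a} → inj₁ a ∈ map label T → ∃ λ u → u ∈ T × ¬ RowMate u × proj₁ u ≡ a
  row-label⇒unmated a∈ with u , u∈T , eq ← ∈-map⁻ label a∈ with rowMate? u
  ... | no unmated = u , u∈T , unmated , inj₁-injective (sym eq)

  column-label⇒mated : ∀ {b} → inj₂ b ∈ map label T → ∃ λ u → u ∈ T × RowMate u × proj₂ u ≡ b
  column-label⇒mated b∈ with u , u∈T , eq ← ∈-map⁻ label b∈ with rowMate? u
  ... | yes mated = u , u∈T , mated , inj₂-injective (sym eq)

labels : ∀ m n → List (Fin m ⊎ Fin n)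
labels m n = map inj₁ (allFin m) ++ map inj₂ (allFin n)

∈-labels : ∀ {m n} (ℓ : Fin m ⊎ Fin n) → ℓ ∈ labels m n
∈-labels         (inj₁ a) = ∈-++⁺ˡ (∈-map⁺ inj₁ (∈-allFin a))
∈-labels {m = m} (inj₂ b) = ∈-++⁺ʳ (map inj₁ (allFin m)) (∈-map⁺ inj₂ (∈-allFin b))

length-labels : ∀ m n → length (labels m n) ≡ m + n
length-labels m n = begin
  length (map inj₁ (allFin m) ++ map inj₂ (allFin n))
    ≡⟨ length-++ (map inj₁ (allFin m)) ⟩
  length (map inj₁ (allFin m)) + length (map inj₂ (allFin n))
    ≡⟨ cong₂ _+_ (trans (length-map inj₁ (allFin m)) (length-allFin m))
                 (trans (length-map inj₂ (allFin n)) (length-allFin n)) ⟩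
  m + n
    ∎
  where open ≡-Reasoning

module _ {m n} {T : List (Cell (suc (suc m)) (suc (suc n)))} (T-ellFree : EllFree T) where

  open EllFreeLabelling T-ellFree

  two-unused-labels : ∃₂ λ x y → x ≢ y × x ∉ map label T × y ∉ map label T
  two-unused-labels with any? (¬? ∘ rowMate?) T | any? rowMate? T
  ... | no no-unmated | _ = inj₁ zero , inj₁ (suc zero) , (λ ()) , no-row-label , no-row-label
    where
    no-row-label : ∀ {a} → inj₁ a ∉ map label T
    no-row-label a∈ with u , u∈T , u-unmated , _ ← row-label⇒unmated a∈ = no-unmated (lose u∈T u-unmated)
  ... | yes _ | no no-mated = inj₂ zero , inj₂ (suc zero) , (λ ()) , no-column-label , no-column-label
    where
    no-column-label : ∀ {b} → inj₂ b ∉ map label T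
    no-column-label b∈ with u , u∈T , u-mated , _ ← column-label⇒mated b∈ = no-mated (lose u∈T u-mated)
  ... | yes some-unmated | yes some-mated
    with w , w∈T , w-unmated ← find some-unmated | v , v∈T , v-mated ← find some-mated =
    inj₁ (proj₁ v) , inj₂ (proj₂ w) , (λ ()) , v-row-unused , w-column-unused
    where
    v-row-unused : inj₁ (proj₁ v) ∉ map label T
    v-row-unused a∈ with u , u∈T , u-unmated , same-row ← row-label⇒unmated a∈ =
      u-unmated (subst RowMate (unmated-alone-in-row u-unmated v∈T (sym same-row)) v-mated)

    w-column-unused : inj₂ (proj₂ w) ∉ map label T
    w-column-unused b∈ with u , u∈T , u-mated , same-column ← column-label⇒mated b∈ =
      w-unmated (subst RowMate (sym (mated-alone-in-column u∈T u-mated w∈T (sym same-column))) u-mated)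

  ellFree-length≤ : Unique T → 2 + length T ≤ suc (suc m) + suc (suc n)
  ellFree-length≤ T! with x , y , x≢y , x∉ , y∉ ← two-unused-labels = begin
    2 + length T                                 ≡⟨ cong (2 +_) (length-map label T) ⟨
    length (x ∷ y ∷ map label T)                 ≤⟨ unique-⊆⇒length≤ labels-unique (λ {ℓ} _ → ∈-labels ℓ) ⟩
    length (labels (suc (suc m)) (suc (suc n)))  ≡⟨ length-labels (suc (suc m)) (suc (suc n)) ⟩
    suc (suc m) + suc (suc n)                    ∎
    where
    open ≤-Reasoning
    labels-unique : Unique (x ∷ y ∷ map label T)
    labels-unique = (x≢y ∷ ¬Any⇒All¬ _ x∉) ∷ ¬Any⇒All¬ _ y∉ ∷ unique-map⁺ label label-injective T!

cells : ∀ m n → List (Cell m n)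
cells m n = cartesianProduct (allFin m) (allFin n)

cells-unique : ∀ m n → Unique (cells m n)
cells-unique m n = cartesianProduct⁺ (allFin⁺ m) (allFin⁺ n)

length-cells : ∀ m n → length (cells m n) ≡ m * n
length-cells m n = begin
  length (cells m n)                    ≡⟨ length-cartesianProductWith _,_ (allFin m) (allFin n) ⟩
  length (allFin m) * length (allFin n) ≡⟨ cong₂ _*_ (length-allFin m) (length-allFin n) ⟩
  m * n                                 ∎
  where open ≡-Reasoning

_∉?_ : ∀ {m n} (v : Cell m n) S → Dec (v ∉ S)
v ∉? S = ¬? (any? (v ≟ᶜ_) S)

complement : ∀ {m n} → List (Cell m n) → List (Cell m n)
complement S = filter (_∉? S) (cells _ _)

cells⊆S++complement : ∀ {m n} (S : List (Cell m n)) → cells m n ⊆ S ++ complement S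
cells⊆S++complement S {v} v∈cells with any? (v ≟ᶜ_) S
... | yes v∈S = ∈-++⁺ˡ v∈S
... | no v∉S  = ∈-++⁺ʳ S (∈-filter⁺ (_∉? S) v∈cells v∉S)

meetsEveryEll⇒complement-ellFree : ∀ {m n} {S : List (Cell m n)} → MeetsEveryEll S → EllFree (complement S)
meetsEveryEll⇒complement-ellFree {S = S} meets P-ell all∈complement
  with v∈complement , v∈S ← All.lookupAny all∈complement (meets P-ell) =
  proj₂ (∈-filter⁻ (_∉? S) {xs = cells _ _} v∈complement) v∈S

rook-count-identity : ∀ m n → suc (suc m * suc n) + (suc (suc m) + suc (suc n)) ≡ suc (suc m) * suc (suc n) + 2
rook-count-identity = solve-∀

transversal-length≥ : ∀ {m n} {S : List (Cell (suc (suc m)) (suc (suc n)))} →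
                      IsGeodesicTransversal (K _ □ K _) S → suc (suc m * suc n) ≤ length S
transversal-length≥ {m} {n} {S} transversal =
  +-cancelʳ-≤ (M + N) _ _ (begin
    suc (suc m * suc n) + (M + N)  ≡⟨ rook-count-identity m n ⟩
    M * N + 2                      ≤⟨ +-monoˡ-≤ 2 cells≤S+T ⟩
    length S + length T + 2        ≡⟨ +-assoc (length S) (length T) 2 ⟩
    length S + (length T + 2)      ≡⟨ cong (length S +_) (+-comm (length T) 2) ⟩
    length S + (2 + length T)      ≤⟨ +-monoʳ-≤ (length S) T≤ ⟩
    length S + (M + N)             ∎)
  where
  open ≤-Reasoning
  M = suc (suc m)
  N = suc (suc n)
  T = complement S

  cells≤S+T : M * N ≤ length S + length T
  cells≤S+T = begin
    M * N                ≡⟨ length-cells M N ⟨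
    length (cells M N)   ≤⟨ unique-⊆⇒length≤ (cells-unique M N) (cells⊆S++complement S) ⟩
    length (S ++ T)      ≡⟨ length-++ S ⟩
    length S + length T  ∎

  T≤ : 2 + length T ≤ M + N
  T≤ = ellFree-length≤ (meetsEveryEll⇒complement-ellFree (transversal⇒meetsEveryEll transversal))
                       (unique-filter⁺ (_∉? S) (cells-unique M N))

-- Its complement, the rest of row 0 and of column 0, is an ell-free set of the largest possible size m + n.
cornerCells : ∀ m n → List (Cell (suc m) (suc n))
cornerCells m n = (zero , zero) ∷ cartesianProductWith (λ a b → suc a , suc b) (allFin m) (allFin n)

∈-cornerCells : ∀ {m n} (a : Fin m) (b : Fin n) → (suc a , suc b) ∈ cornerCells m n
∈-cornerCells a b = there (∈-cartesianProductWith⁺ _ (∈-allFin a) (∈-allFin b))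

cornerCells-unique : ∀ m n → Unique (cornerCells m n)
cornerCells-unique m n =
  All.tabulate origin-not-shifted ∷ cartesianProductWith⁺ _ (λ { refl → refl , refl }) (allFin⁺ m) (allFin⁺ n)
  where
  origin-not-shifted : ∀ {v} → v ∈ cartesianProductWith (λ a b → suc a , suc b) (allFin m) (allFin n) → (zero , zero) ≢ v
  origin-not-shifted v∈ with _ , _ , _ , _ , refl ← ∈-cartesianProductWith⁻ _ (allFin m) (allFin n) v∈ = λ ()

length-cornerCells : ∀ m n → length (cornerCells m n) ≡ suc (m * n)
length-cornerCells m n = cong suc (begin
  length (cartesianProductWith (λ a b → suc a , suc b) (allFin m) (allFin n))
    ≡⟨ length-cartesianProductWith _ (allFin m) (allFin n) ⟩
  length (allFin m) * length (allFin n)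
    ≡⟨ cong₂ _*_ (length-allFin m) (length-allFin n) ⟩
  m * n
    ∎)
  where open ≡-Reasoning

cornerCells-meetsEveryEll : ∀ {m n} → MeetsEveryEll (cornerCells m n)
cornerCells-meetsEveryEll (ell {suc a} {suc b}                 _   _)   = here (∈-cornerCells a b)
cornerCells-meetsEveryEll (ell {c = suc c} {d = suc d}         _   _)   = there (there (here (∈-cornerCells c d)))
cornerCells-meetsEveryEll (ell {suc a} {d = suc d}             _   _)   = there (here (∈-cornerCells a d))
cornerCells-meetsEveryEll (ell {zero} {c = zero}               a≢c _)   = contradiction refl a≢c
cornerCells-meetsEveryEll (ell {zero} {c = suc _} {d = zero}   _   _)   = there (here (here refl))
cornerCells-meetsEveryEll (ell {suc _} {zero} {d = zero}       _   b≢d) = contradiction refl b≢d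

gt-rook : ∀ m n → GtIs (K (suc (suc m)) □ K (suc (suc n))) (suc (suc m * suc n))
gt-rook m n =
  (cornerCells (suc m) (suc n) ,
   meetsEveryEll⇒transversal (cornerCells-unique (suc m) (suc n)) cornerCells-meetsEveryEll ,
   length-cornerCells (suc m) (suc n)) ,
  λ S → transversal-length≥

K₁□K₁-cell : (v : Cell 1 1) → v ≡ (zero , zero)
K₁□K₁-cell (zero , zero)  = refl
K₁□K₁-cell (zero , suc ())
K₁□K₁-cell (suc () , _)

K₁□K₁-isMaximalGeodesic : IsMaximalGeodesic (K 1 □ K 1) ((zero , zero) ∷ [])
K₁□K₁-isMaximalGeodesic = (_ , _ , path₁ (K 1 □ K 1) _ , nonempty) , maximal
  where
  nonempty : ∀ Q → PathFromTo (K 1 □ K 1) _ _ Q → 1 ≤ length Q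
  nonempty []      ((Q≢[] , _) , _) = contradiction refl Q≢[]
  nonempty (_ ∷ _) _                = s≤s z≤n

  maximal : ∀ Q → IsGeodesic (K 1 □ K 1) Q → Infix _≡_ ((zero , zero) ∷ []) Q → Q ≡ (zero , zero) ∷ []
  maximal Q (u , v , _ , shortest) P⊑Q =
    infix-≡ P⊑Q (shortest _ (subst (λ w → PathFromTo (K 1 □ K 1) u w (u ∷ []))
                                   (trans (K₁□K₁-cell u) (sym (K₁□K₁-cell v))) (path₁ (K 1 □ K 1) u)))

gt-K₁□K₁ : GtIs (K 1 □ K 1) 1
gt-K₁□K₁ = (origin ∷ [] , ([] ∷ [] , hits) , refl) , λ S (_ , S-hits) → origin∈⇒1≤length (S-hits _ K₁□K₁-isMaximalGeodesic)
  where
  origin = (zero , zero)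
  hits : ∀ P → IsMaximalGeodesic (K 1 □ K 1) P → Any (_∈ origin ∷ []) P
  hits [] ((_ , _ , ((P≢[] , _) , _) , _) , _) = contradiction refl P≢[]
  hits (v ∷ _) _ = here (here (K₁□K₁-cell v))
  origin∈⇒1≤length : ∀ {S} → Any (_∈ S) (origin ∷ []) → 1 ≤ length S
  origin∈⇒1≤length (here origin∈S) = unique-⊆⇒length≤ ([] ∷ []) λ { (here refl) → origin∈S }

square-formula : ∀ k → suc (suc k) * suc (suc k) + 2 ∸ 2 * suc (suc k) ≡ suc (suc k * suc k)
square-formula k = begin
  suc (suc k) * suc (suc k) + 2 ∸ 2 * suc (suc k)            ≡⟨ cong (_∸ 2 * suc (suc k)) (expand k) ⟩
  suc (suc k * suc k) + 2 * suc (suc k) ∸ 2 * suc (suc k)    ≡⟨ m+n∸n≡m (suc (suc k * suc k)) (2 * suc (suc k)) ⟩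
  suc (suc k * suc k)                                        ∎
  where
  open ≡-Reasoning
  expand : ∀ k → suc (suc k) * suc (suc k) + 2 ≡ suc (suc k * suc k) + 2 * suc (suc k)
  expand = solve-∀

proposition2p6 : (n : ℕ) → 1 ≤ n → GtIs (K n □ K n) (n * n + 2 ∸ 2 * n)
proposition2p6 1             _ = gt-K₁□K₁
proposition2p6 (suc (suc k)) _ = subst (GtIs (K (suc (suc k)) □ K (suc (suc k)))) (sym (square-formula k)) (gt-rook k k)
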